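{- For every integer $n \geq 1$ we have $\frac{3n+7}{5} \leq m(s(n)) \leq 3n+1$. Moreover both bounds are tight: there are infinitely many $n\ge1$ with $m(s(n))=3n+1$, and infinitely many $n\ge 1$ with $5\,m(s(n))=3n+7$.
   Context: Let $(a(n))_{n\ge 0}$ be the Rudin-Shapiro sequence, defined by $a(0)=1$, $a(2n)=a(n)$, $a(2n+1)=(-1)^n a(n)$ for $n\ge 0$. Let $s(n)=\sum_{0\le i\le n} a(i)$ (which is a positive integer for all $n$). For $k\ge 0$, $m(k)$ denotes the integer obtained by reading the base-$2$ representation of $k$ as a base-$4$ numeral; i.e., if $k=\sum_i c_i 2^i$ with $c_i\in\{0,1\}$, then $m(k)=\sum_i c_i 4^i$. -}

module Defs where

open import Data.Nat using (ℕ; zero; suc; _+_; _*_; ⌊_/2⌋)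
open import Data.Nat.Base using (_%_)
open import Data.Integer using (ℤ; +_; -_; ∣_∣) renaming (_+_ to _+ℤ_; _*_ to _*ℤ_)
open import Data.Bool using (Bool; true; false; if_then_else_)
open import Data.Nat using (_≡ᵇ_)

isOdd : ℕ → Bool
isOdd n = (n % 2) ≡ᵇ 1

sign : ℕ → ℤ
sign n = if isOdd n then - (+ 1) else + 1

-- Rudin-Shapiro with fuel; fuel ≥ n suffices since ⌊n/2⌋ < n for n ≥ 1.
-- a(0)=1, a(2k)=a(k), a(2k+1)=(-1)^k a(k)
rsF : ℕ → ℕ → ℤ
rsF zero    _ = + 1
rsF (suc f) zero = + 1
rsF (suc f) (suc n) =
  let k = ⌊ suc n /2⌋ in
  if isOdd (suc n) then sign k *ℤ rsF f k else rsF f k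

rs : ℕ → ℤ
rs n = rsF n n

s : ℕ → ℤ
s zero    = rs 0
s (suc n) = s n +ℤ rs (suc n)

-- m(k): read binary digits of k in base 4 (with fuel ≥ k)
mF : ℕ → ℕ → ℕ
mF zero    _ = 0
mF (suc f) zero = 0
mF (suc f) (suc n) = (suc n % 2) + 4 * mF f ⌊ suc n /2⌋

m : ℕ → ℕ
m k = mF k k

-- m(s(n)); s(n) is a positive integer, so we take its absolute value as a natural
ms : ℕ → ℕ
ms n = m ∣ s n ∣

module Submission where

-- Along the base-4 expansion of n everything is driven by the digits: a(4q+r) is read off from
-- a(q) and a(2q+1), while s(4q) = 2s(q) - a(q), s(4q+1) = s(4q+3) = 2s(q), s(4q+2) = 2s(q) + a(2q+1)
-- and m(2x+c) = 4m(x)+c. So appending a digit multiplies both 3n - m(s(n)) and 5m(s(n)) - 3n by 4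
-- up to a bounded error, and the bounds propagate once they hold with a little slack. The slack
-- depends on the pair (a(n), a(2n+1)), and since s can move to 2s(n) - 1 the induction also has to
-- carry bounds on m(s(n) - 1); each of the finitely many digit transitions is then a numerical check.
-- For tightness, appending the digit 1 to n = 1 preserves m(s(n)) = 3n+1, and appending the
-- digit 2 to n = 6 preserves 5m(s(n)) = 3n+7.

open import Defs
open import Data.Bool using (Bool; T; if_then_else_)
open import Data.Fin using (Fin; toℕ)
open import Data.Fin.Patterns using (0F; 1F; 2F; 3F)
open import Data.Integer using (ℤ; +_; -_; _◃_; ∣_∣) renaming (_+_ to _+ℤ_; _*_ to _*ℤ_)
open import Data.Integer.Properties using (*-identityˡ; -1*i≡-i; abs-*; +-comm)
import Data.Integer.Tactic.RingSolver as ℤ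
open import Data.Nat
  using (ℕ; zero; suc; _+_; _*_; _≤_; _<_; _≥_; _≤ᵇ_; _≡ᵇ_; z≤n; s≤s; s≤s⁻¹; ⌊_/2⌋; _%_; >-nonZero)
open import Data.Nat.DivMod using ([m+kn]%n≡m%n)
open import Data.Nat.Properties
  using (≤-refl; ≤-trans; <-≤-trans; ≤-<-trans; <⇒≤; ⌊n/2⌋<n; *-assoc; *-distribˡ-+; m≤n+m; m<m*n;
         m+n≤o⇒m≤o; +-monoˡ-≤; +-monoʳ-≤; *-monoʳ-≤; +-cancelʳ-≤; ≤ᵇ⇒≤; module ≤-Reasoning)
open import Data.Nat.Tactic.RingSolver using (solve)
open import Data.Product using (Σ; ∃-syntax; _×_; _,_)
open import Data.Sign using (Sign)
open import Data.List using ([]; _∷_)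
open import Relation.Binary.PropositionalEquality
  using (_≡_; refl; sym; trans; cong; cong₂; subst; module ≡-Reasoning)

module HalvingRecursion {A : Set} (F : ℕ → ℕ → A)
  (F-zero : ∀ f → F f 0 ≡ F 0 0)
  (F-suc : ∀ f g n → F f ⌊ suc n /2⌋ ≡ F g ⌊ suc n /2⌋ →
                      F (suc f) (suc n) ≡ F (suc g) (suc n))
  where

  fuel-irrelevant : ∀ {f g n} → n ≤ f → n ≤ g → F f n ≡ F g n
  fuel-irrelevant {f} {g} {zero} _ _ = trans (F-zero f) (sym (F-zero g))
  fuel-irrelevant {suc f} {suc g} {suc n} (s≤s n≤f) (s≤s n≤g) =
    F-suc f g n (fuel-irrelevant (≤-trans half≤n n≤f) (≤-trans half≤n n≤g))
    where half≤n = s≤s⁻¹ (⌊n/2⌋<n n)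

  enough-fuel : ∀ n → F n ⌊ suc n /2⌋ ≡ F ⌊ suc n /2⌋ ⌊ suc n /2⌋
  enough-fuel n = fuel-irrelevant (s≤s⁻¹ (⌊n/2⌋<n n)) ≤-refl

rs-from-half : Bool → ℕ → ℤ
rs-from-half odd k = if odd then sign k *ℤ rs k else rs k

rs-unfold : ∀ n → rs n ≡ rs-from-half (isOdd n) ⌊ n /2⌋
rs-unfold zero    = refl
rs-unfold (suc n) = rs-suc n ⌊ suc n /2⌋ n (enough-fuel n)
  where
  rs-suc : ∀ f g n → rsF f ⌊ suc n /2⌋ ≡ rsF g ⌊ suc n /2⌋ →
                     rsF (suc f) (suc n) ≡ rsF (suc g) (suc n)
  rs-suc _ _ n = cong (λ x → if isOdd (suc n) then sign ⌊ suc n /2⌋ *ℤ x else x)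
  rs-zero : ∀ f → rsF f 0 ≡ rsF 0 0
  rs-zero zero    = refl
  rs-zero (suc _) = refl
  open HalvingRecursion rsF rs-zero rs-suc

m-unfold : ∀ n → m n ≡ n % 2 + 4 * m ⌊ n /2⌋
m-unfold zero    = refl
m-unfold (suc n) = m-suc n ⌊ suc n /2⌋ n (enough-fuel n)
  where
  m-suc : ∀ f g n → mF f ⌊ suc n /2⌋ ≡ mF g ⌊ suc n /2⌋ →
                    mF (suc f) (suc n) ≡ mF (suc g) (suc n)
  m-suc _ _ n = cong (λ x → suc n % 2 + 4 * x)
  m-zero : ∀ f → mF f 0 ≡ mF 0 0
  m-zero zero    = refl
  m-zero (suc _) = refl
  open HalvingRecursion mF m-zero m-suc

⌊2n/2⌋≡n : ∀ n → ⌊ n * 2 /2⌋ ≡ n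
⌊2n/2⌋≡n zero    = refl
⌊2n/2⌋≡n (suc n) = cong suc (⌊2n/2⌋≡n n)

⌊1+2n/2⌋≡n : ∀ n → ⌊ 1 + n * 2 /2⌋ ≡ n
⌊1+2n/2⌋≡n zero    = refl
⌊1+2n/2⌋≡n (suc n) = cong suc (⌊1+2n/2⌋≡n n)

isOdd-+-*2 : ∀ r k → isOdd (r + k * 2) ≡ isOdd r
isOdd-+-*2 r k = cong (_≡ᵇ 1) ([m+kn]%n≡m%n r k 2)

sign-+-*2 : ∀ r k → sign (r + k * 2) ≡ sign r
sign-+-*2 r k = cong (λ odd → if odd then - (+ 1) else + 1) (isOdd-+-*2 r k)

rs-even : ∀ n → rs (n * 2) ≡ rs n
rs-even n = trans (rs-unfold (n * 2))
  (cong₂ rs-from-half (isOdd-+-*2 0 n) (⌊2n/2⌋≡n n))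

rs-odd : ∀ n → rs (1 + n * 2) ≡ sign n *ℤ rs n
rs-odd n = trans (rs-unfold (1 + n * 2))
  (cong₂ rs-from-half (isOdd-+-*2 1 n) (⌊1+2n/2⌋≡n n))

m-even : ∀ n → m (n * 2) ≡ 4 * m n
m-even n = trans (m-unfold (n * 2))
  (cong₂ (λ c k → c + 4 * m k) ([m+kn]%n≡m%n 0 n 2) (⌊2n/2⌋≡n n))

m-odd : ∀ n → m (1 + n * 2) ≡ 1 + 4 * m n
m-odd n = trans (m-unfold (1 + n * 2))
  (cong₂ (λ c k → c + 4 * m k) ([m+kn]%n≡m%n 1 n 2) (⌊1+2n/2⌋≡n n))

n*4≡n*2*2 : ∀ n → n * 4 ≡ n * 2 * 2
n*4≡n*2*2 n = sym (*-assoc n 2 2)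

sign-4n+r : ∀ r n → sign (r + n * 4) ≡ sign r
sign-4n+r r n = trans (cong (λ k → sign (r + k)) (n*4≡n*2*2 n)) (sign-+-*2 r (n * 2))

rs-4n : ∀ n → rs (n * 4) ≡ rs n
rs-4n n = trans (cong rs (n*4≡n*2*2 n)) (trans (rs-even (n * 2)) (rs-even n))

rs-4n+1 : ∀ n → rs (1 + n * 4) ≡ rs n
rs-4n+1 n = begin
  rs (1 + n * 4)               ≡⟨ cong (λ k → rs (1 + k)) (n*4≡n*2*2 n) ⟩
  rs (1 + n * 2 * 2)           ≡⟨ rs-odd (n * 2) ⟩
  sign (n * 2) *ℤ rs (n * 2)   ≡⟨ cong₂ _*ℤ_ (sign-+-*2 0 n) (rs-even n) ⟩
  + 1 *ℤ rs n                  ≡⟨ *-identityˡ (rs n) ⟩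
  rs n                         ∎
  where open ≡-Reasoning

rs-4n+2 : ∀ n → rs (2 + n * 4) ≡ rs (1 + n * 2)
rs-4n+2 n = trans (cong (λ k → rs (2 + k)) (n*4≡n*2*2 n)) (rs-even (1 + n * 2))

rs-4n+3 : ∀ n → rs (3 + n * 4) ≡ - rs (1 + n * 2)
rs-4n+3 n = begin
  rs (3 + n * 4)                           ≡⟨ cong (λ k → rs (3 + k)) (n*4≡n*2*2 n) ⟩
  rs (1 + (1 + n * 2) * 2)                 ≡⟨ rs-odd (1 + n * 2) ⟩
  sign (1 + n * 2) *ℤ rs (1 + n * 2)       ≡⟨ cong (_*ℤ rs (1 + n * 2)) (sign-+-*2 1 n) ⟩
  - (+ 1) *ℤ rs (1 + n * 2)                ≡⟨ -1*i≡-i (rs (1 + n * 2)) ⟩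
  - rs (1 + n * 2)                         ∎
  where open ≡-Reasoning

rs-odd-4n+r : ∀ r n → rs (1 + (r + n * 4) * 2) ≡ sign r *ℤ rs (r + n * 4)
rs-odd-4n+r r n = trans (rs-odd (r + n * 4)) (cong (_*ℤ rs (r + n * 4)) (sign-4n+r r n))

mutual
  s-4n : ∀ n → s (n * 4) ≡ - rs n +ℤ s n *ℤ + 2
  s-4n zero    = refl
  s-4n (suc n) = trans (cong₂ _+ℤ_ (s-4n+3 n) (rs-4n (suc n))) (regroup (s n) (rs (suc n)))
    where
    regroup : ∀ S a → S *ℤ + 2 +ℤ a ≡ - a +ℤ (S +ℤ a) *ℤ + 2
    regroup = ℤ.solve-∀

  s-4n+1 : ∀ n → s (1 + n * 4) ≡ s n *ℤ + 2
  s-4n+1 n = trans (cong₂ _+ℤ_ (s-4n n) (rs-4n+1 n)) (cancel (s n) (rs n))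
    where
    cancel : ∀ S a → - a +ℤ S *ℤ + 2 +ℤ a ≡ S *ℤ + 2
    cancel = ℤ.solve-∀

  s-4n+2 : ∀ n → s (2 + n * 4) ≡ rs (1 + n * 2) +ℤ s n *ℤ + 2
  s-4n+2 n = trans (cong₂ _+ℤ_ (s-4n+1 n) (rs-4n+2 n)) (+-comm (s n *ℤ + 2) (rs (1 + n * 2)))

  s-4n+3 : ∀ n → s (3 + n * 4) ≡ s n *ℤ + 2
  s-4n+3 n = trans (cong₂ _+ℤ_ (s-4n+2 n) (rs-4n+3 n)) (cancel (s n) (rs (1 + n * 2)))
    where
    cancel : ∀ S b → b +ℤ S *ℤ + 2 +ℤ - b ≡ S *ℤ + 2
    cancel = ℤ.solve-∀

record Snapshot : Set where
  constructor snap
  field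
    a b : Sign
    w   : ℕ

record SnapshotOf (n : ℕ) (σ : Snapshot) : Set where
  constructor observed
  open Snapshot σ
  field
    rs-n    : rs n ≡ a ◃ 1
    rs-2n+1 : rs (1 + n * 2) ≡ b ◃ 1
    s-n     : s n ≡ + suc w

step : Fin 4 → Snapshot → Snapshot
step 0F (snap Sign.+ _ w) = snap Sign.+ Sign.+ (w * 2)
step 0F (snap Sign.- _ w) = snap Sign.- Sign.- (suc w * 2)
step 1F (snap Sign.+ _ w) = snap Sign.+ Sign.- (1 + w * 2)
step 1F (snap Sign.- _ w) = snap Sign.- Sign.+ (1 + w * 2)
step 2F (snap _ Sign.+ w) = snap Sign.+ Sign.+ (suc w * 2)
step 2F (snap _ Sign.- w) = snap Sign.- Sign.- (w * 2)
step 3F (snap _ Sign.+ w) = snap Sign.- Sign.+ (1 + w * 2)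
step 3F (snap _ Sign.- w) = snap Sign.+ Sign.- (1 + w * 2)

child-snapshot : ∀ r {q a b w} → rs (r + q * 4) ≡ a ◃ 1 → sign r *ℤ (a ◃ 1) ≡ b ◃ 1 →
                 s (r + q * 4) ≡ + suc w → SnapshotOf (r + q * 4) (snap a b w)
child-snapshot r {q} eA eB eS =
  observed eA (trans (rs-odd-4n+r r q) (trans (cong (sign r *ℤ_) eA) eB)) eS

-- Clauses come in identical pairs: the split only lets `step` and the integer arithmetic compute.
snapshot-step : ∀ r {q} σ → SnapshotOf q σ → SnapshotOf (toℕ r + q * 4) (step r σ)
snapshot-step 0F {q} (snap Sign.+ _ _) (observed eA _ eS) =
  child-snapshot 0 {q} (trans (rs-4n q) eA) refl
    (trans (s-4n q) (cong₂ (λ a S → - a +ℤ S *ℤ + 2) eA eS))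
snapshot-step 0F {q} (snap Sign.- _ _) (observed eA _ eS) =
  child-snapshot 0 {q} (trans (rs-4n q) eA) refl
    (trans (s-4n q) (cong₂ (λ a S → - a +ℤ S *ℤ + 2) eA eS))
snapshot-step 1F {q} (snap Sign.+ _ _) (observed eA _ eS) =
  child-snapshot 1 {q} (trans (rs-4n+1 q) eA) refl
    (trans (s-4n+1 q) (cong (_*ℤ + 2) eS))
snapshot-step 1F {q} (snap Sign.- _ _) (observed eA _ eS) =
  child-snapshot 1 {q} (trans (rs-4n+1 q) eA) refl
    (trans (s-4n+1 q) (cong (_*ℤ + 2) eS))
snapshot-step 2F {q} (snap _ Sign.+ _) (observed _ eB eS) =
  child-snapshot 2 {q} (trans (rs-4n+2 q) eB) refl
    (trans (s-4n+2 q) (cong₂ (λ b S → b +ℤ S *ℤ + 2) eB eS))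
snapshot-step 2F {q} (snap _ Sign.- _) (observed _ eB eS) =
  child-snapshot 2 {q} (trans (rs-4n+2 q) eB) refl
    (trans (s-4n+2 q) (cong₂ (λ b S → b +ℤ S *ℤ + 2) eB eS))
snapshot-step 3F {q} (snap _ Sign.+ _) (observed _ eB eS) =
  child-snapshot 3 {q} (trans (rs-4n+3 q) (cong -_ eB)) refl
    (trans (s-4n+3 q) (cong (_*ℤ + 2) eS))
snapshot-step 3F {q} (snap _ Sign.- _) (observed _ eB eS) =
  child-snapshot 3 {q} (trans (rs-4n+3 q) (cong -_ eB)) refl
    (trans (s-4n+3 q) (cong (_*ℤ + 2) eS))

record Window (α γ n t : ℕ) : Set where
  constructor window
  field
    upper : m t + α ≤ 3 * n + 1
    lower : 3 * n + γ ≤ 5 * m t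

upper-scale : ∀ c r {α α' q x} → x + α ≤ 3 * q + 1 → c + α' + 3 ≤ 4 * α + 3 * r →
              c + 4 * x + α' ≤ 3 * (r + q * 4) + 1
upper-scale c r {α} {α'} {q} {x} x≤ side = +-cancelʳ-≤ (4 * α) _ _ (begin
  c + 4 * x + α' + 4 * α      ≡⟨ solve (c ∷ r ∷ α ∷ α' ∷ q ∷ x ∷ []) ⟩
  4 * (x + α) + (c + α')      ≤⟨ +-monoˡ-≤ (c + α') (*-monoʳ-≤ 4 x≤) ⟩
  4 * (3 * q + 1) + (c + α')  ≡⟨ solve (c ∷ r ∷ α ∷ α' ∷ q ∷ x ∷ []) ⟩
  q * 12 + (c + α' + 3) + 1   ≤⟨ +-monoˡ-≤ 1 (+-monoʳ-≤ (q * 12) side) ⟩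
  q * 12 + (4 * α + 3 * r) + 1 ≡⟨ solve (c ∷ r ∷ α ∷ α' ∷ q ∷ x ∷ []) ⟩
  3 * (r + q * 4) + 1 + 4 * α  ∎)
  where open ≤-Reasoning

lower-scale : ∀ c r {γ γ' q x} → 3 * q + γ ≤ 5 * x → 3 * r + γ' ≤ 5 * c + 4 * γ →
              3 * (r + q * 4) + γ' ≤ 5 * (c + 4 * x)
lower-scale c r {γ} {γ'} {q} {x} ≤x side = begin
  3 * (r + q * 4) + γ'     ≡⟨ solve (c ∷ r ∷ γ ∷ γ' ∷ q ∷ x ∷ []) ⟩
  q * 12 + (3 * r + γ')    ≤⟨ +-monoʳ-≤ (q * 12) side ⟩
  q * 12 + (5 * c + 4 * γ) ≡⟨ solve (c ∷ r ∷ γ ∷ γ' ∷ q ∷ x ∷ []) ⟩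
  4 * (3 * q + γ) + 5 * c  ≤⟨ +-monoˡ-≤ (5 * c) (*-monoʳ-≤ 4 ≤x) ⟩
  4 * (5 * x) + 5 * c      ≡⟨ solve (c ∷ r ∷ γ ∷ γ' ∷ q ∷ x ∷ []) ⟩
  5 * (c + 4 * x)          ∎
  where open ≤-Reasoning

-- At every use the side conditions are closed, so they reduce to ⊤ and are filled in by Agda.
window-scale : ∀ c r {α γ α' γ' q t t'} → m t' ≡ c + 4 * m t →
               {T (c + α' + 3 ≤ᵇ 4 * α + 3 * r)} → {T (3 * r + γ' ≤ᵇ 5 * c + 4 * γ)} →
               Window α γ q t → Window α' γ' (r + q * 4) t'
window-scale c r {α} {γ} {α'} {γ'} {q} {t} m-t' {up} {low} (window x≤ ≤x) = window
  (subst (λ x → x + α' ≤ _) (sym m-t') (upper-scale c r {α} {α'} {q} {m t} x≤ (≤ᵇ⇒≤ _ _ up)))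
  (subst (λ x → _ ≤ 5 * x) (sym m-t') (lower-scale c r {γ} {γ'} {q} {m t} ≤x (≤ᵇ⇒≤ _ _ low)))

window-even : ∀ r {α γ α' γ' q t} →
              {T (α' + 3 ≤ᵇ 4 * α + 3 * r)} → {T (3 * r + γ' ≤ᵇ 4 * γ)} →
              Window α γ q t → Window α' γ' (r + q * 4) (t * 2)
window-even r {t = t} {up} {low} = window-scale 0 r (m-even t) {up} {low}

window-odd : ∀ r {α γ α' γ' q t} →
             {T (1 + α' + 3 ≤ᵇ 4 * α + 3 * r)} → {T (3 * r + γ' ≤ᵇ 5 + 4 * γ)} →
             Window α γ q t → Window α' γ' (r + q * 4) (1 + t * 2)
window-odd r {t = t} {up} {low} = window-scale 1 r (m-odd t) {up} {low}

-- m(s(n) - 1) only enters a child's windows through 2s(n) - 1, which occurs there unless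
-- a(n) = -1 and a(2n+1) = 1.
Bounds : Snapshot → ℕ → Set
Bounds (snap Sign.+ _ w)       n = Window 0 7 n (suc w) × Window 3 2 n w
Bounds (snap Sign.- Sign.- w) n = Window 2 7 n (suc w) × Window 3 2 n w
Bounds (snap Sign.- Sign.+ w) n = Window 2 7 n (suc w)

bounds-step : ∀ r σ {q} → Bounds σ q → Bounds (step r σ) (toℕ r + q * 4)
bounds-step 0F (snap Sign.+ _ _)       (_ , l) = window-odd 0 l , window-even 0 l
bounds-step 0F (snap Sign.- Sign.- _) (u , _) = window-odd 0 u , window-even 0 u
bounds-step 0F (snap Sign.- Sign.+ _) u       = window-odd 0 u , window-even 0 u
bounds-step 1F (snap Sign.+ _ _)       (u , l) = window-even 1 u , window-odd 1 l
bounds-step 1F (snap Sign.- Sign.- _) (u , _) = window-even 1 u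
bounds-step 1F (snap Sign.- Sign.+ _) u       = window-even 1 u
bounds-step 2F (snap Sign.+ Sign.+ _) (u , _) = window-odd 2 u , window-even 2 u
bounds-step 2F (snap Sign.- Sign.+ _) u       = window-odd 2 u , window-even 2 u
bounds-step 2F (snap Sign.+ Sign.- _) (_ , l) = window-odd 2 l , window-even 2 l
bounds-step 2F (snap Sign.- Sign.- _) (_ , l) = window-odd 2 l , window-even 2 l
bounds-step 3F (snap Sign.+ Sign.+ _) (u , _) = window-even 3 u
bounds-step 3F (snap Sign.- Sign.+ _) u       = window-even 3 u
bounds-step 3F (snap Sign.+ Sign.- _) (u , l) = window-even 3 u , window-odd 3 l
bounds-step 3F (snap Sign.- Sign.- _) (u , l) = window-even 3 u , window-odd 3 l

data Base4 : ℕ → Set where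
  [1] : Base4 1
  [2] : Base4 2
  [3] : Base4 3
  _·_ : ∀ {q} → Base4 q → (r : Fin 4) → Base4 (toℕ r + q * 4)

base4-suc : ∀ {n} → Base4 n → Base4 (suc n)
base4-suc [1]      = [2]
base4-suc [2]      = [3]
base4-suc [3]      = [1] · 0F
base4-suc (q · 0F) = q · 1F
base4-suc (q · 1F) = q · 2F
base4-suc (q · 2F) = q · 3F
base4-suc (q · 3F) = base4-suc q · 0F

base4 : ∀ n → Base4 (suc n)
base4 zero    = [1]
base4 (suc n) = base4-suc (base4 n)

Invariant : ℕ → Set
Invariant n = Σ Snapshot λ σ → SnapshotOf n σ × Bounds σ n

invariant : ∀ {n} → Base4 n → Invariant n
invariant [1] = snap Sign.+ Sign.- 1 , observed refl refl refl ,
  window (≤ᵇ⇒≤ _ _ _) (≤ᵇ⇒≤ _ _ _) , window (≤ᵇ⇒≤ _ _ _) (≤ᵇ⇒≤ _ _ _)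
invariant [2] = snap Sign.+ Sign.+ 2 , observed refl refl refl ,
  window (≤ᵇ⇒≤ _ _ _) (≤ᵇ⇒≤ _ _ _) , window (≤ᵇ⇒≤ _ _ _) (≤ᵇ⇒≤ _ _ _)
invariant [3] = snap Sign.- Sign.+ 1 , observed refl refl refl ,
  window (≤ᵇ⇒≤ _ _ _) (≤ᵇ⇒≤ _ _ _)
invariant (q · r) with invariant q
... | σ , obs , bnd = step r σ , snapshot-step r σ obs , bounds-step r σ bnd

ms-of : ∀ {n σ} → SnapshotOf n σ → ms n ≡ m (suc (Snapshot.w σ))
ms-of obs = cong (λ z → m ∣ z ∣) (SnapshotOf.s-n obs)

ms-window : ∀ σ {n} → Bounds σ n → ∃[ α ] Window α 7 n (suc (Snapshot.w σ))
ms-window (snap Sign.+ _ _)       (u , _) = _ , u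
ms-window (snap Sign.- Sign.- _) (u , _) = _ , u
ms-window (snap Sign.- Sign.+ _) u       = _ , u

ms-bounds : ∀ n → n ≥ 1 → (3 * n + 7 ≤ 5 * ms n) × (ms n ≤ 3 * n + 1)
ms-bounds (suc k) _ with invariant (base4 k)
... | σ , obs , bnd with ms-window σ bnd
... | α , window upper lower rewrite ms-of obs = lower , m+n≤o⇒m≤o _ upper

n<r+n*4 : ∀ r {n} → n ≥ 1 → n < r + n * 4
n<r+n*4 r {n} n≥1 = <-≤-trans (m<m*n n 4 {{>-nonZero n≥1}} (≤ᵇ⇒≤ _ _ _)) (m≤n+m (n * 4) r)

iterate-unbounded : ∀ {P : ℕ → Set} r {n₀} → n₀ ≥ 1 → P n₀ → (∀ n → P n → P (r + n * 4)) →
                    ∀ N → ∃[ n ] (n ≥ N × n ≥ 1 × P n)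
iterate-unbounded r {n₀} n₀≥1 P₀ next zero = n₀ , z≤n , n₀≥1 , P₀
iterate-unbounded {P} r n₀≥1 P₀ next (suc N) with iterate-unbounded {P} r n₀≥1 P₀ next N
... | n , n≥N , n≥1 , Pn =
  r + n * 4 , ≤-<-trans n≥N n<n′ , ≤-trans n≥1 (<⇒≤ n<n′) , next n Pn
  where n<n′ = n<r+n*4 r n≥1

ms-4n+1 : ∀ n → ms (1 + n * 4) ≡ 4 * ms n
ms-4n+1 n = begin
  m ∣ s (1 + n * 4) ∣   ≡⟨ cong (λ z → m ∣ z ∣) (s-4n+1 n) ⟩
  m ∣ s n *ℤ + 2 ∣      ≡⟨ cong m (abs-* (s n) (+ 2)) ⟩
  m (∣ s n ∣ * 2)       ≡⟨ m-even ∣ s n ∣ ⟩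
  4 * ms n              ∎
  where open ≡-Reasoning

upper-tight-step : ∀ n → ms n ≡ 3 * n + 1 → ms (1 + n * 4) ≡ 3 * (1 + n * 4) + 1
upper-tight-step n e = begin
  ms (1 + n * 4)         ≡⟨ ms-4n+1 n ⟩
  4 * ms n               ≡⟨ cong (4 *_) e ⟩
  4 * (3 * n + 1)        ≡⟨ solve (n ∷ []) ⟩
  3 * (1 + n * 4) + 1    ∎
  where open ≡-Reasoning

-- Writing s(n) - 1 as t * 2 makes m(s(n)) = 1 + m(s(n) - 1).
LowerTight : ℕ → Set
LowerTight n = ∃[ a ] ∃[ t ] (SnapshotOf n (snap a Sign.- (t * 2)) × 5 * m (t * 2) ≡ 3 * n + 2)

lower-tight-step : ∀ n → LowerTight n → LowerTight (2 + n * 4)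
lower-tight-step n (a , t , obs , e) = Sign.- , t * 2 , snapshot-step 2F _ obs , (begin
  5 * m (t * 2 * 2)      ≡⟨ cong (5 *_) (m-even (t * 2)) ⟩
  5 * (4 * m (t * 2))    ≡⟨ *-assoc 5 4 (m (t * 2)) ⟨
  20 * m (t * 2)         ≡⟨ *-assoc 4 5 (m (t * 2)) ⟩
  4 * (5 * m (t * 2))    ≡⟨ cong (4 *_) e ⟩
  4 * (3 * n + 2)        ≡⟨ solve (n ∷ []) ⟩
  3 * (2 + n * 4) + 2    ∎)
  where open ≡-Reasoning

lower-tight : ∀ {n} → LowerTight n → 5 * ms n ≡ 3 * n + 7
lower-tight {n} (a , t , obs , e) = begin
  5 * ms n                 ≡⟨ cong (5 *_) (trans (ms-of obs) (m-odd t)) ⟩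
  5 * (1 + 4 * m t)        ≡⟨ cong (λ x → 5 * (1 + x)) (sym (m-even t)) ⟩
  5 * (1 + m (t * 2))      ≡⟨ *-distribˡ-+ 5 1 (m (t * 2)) ⟩
  5 + 5 * m (t * 2)        ≡⟨ cong (λ x → 5 + x) e ⟩
  5 + (3 * n + 2)          ≡⟨ solve (n ∷ []) ⟩
  3 * n + 7                ∎
  where open ≡-Reasoning

lower-tight-6 : LowerTight 6
lower-tight-6 = Sign.- , 1 , observed refl refl refl , refl

upper-tight-unbounded : ∀ N → ∃[ n ] (n ≥ N × n ≥ 1 × ms n ≡ 3 * n + 1)
upper-tight-unbounded = iterate-unbounded {λ n → ms n ≡ 3 * n + 1} 1 ≤-refl refl upper-tight-step

lower-tight-unbounded : ∀ N → ∃[ n ] (n ≥ N × n ≥ 1 × 5 * ms n ≡ 3 * n + 7)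
lower-tight-unbounded N
  with iterate-unbounded {LowerTight} 2 (≤ᵇ⇒≤ 1 6 _) lower-tight-6 lower-tight-step N
... | n , n≥N , n≥1 , tight = n , n≥N , n≥1 , lower-tight tight

lemma20 : ((n : ℕ) → n ≥ 1 → (3 * n + 7 ≤ 5 * ms n) × (ms n ≤ 3 * n + 1))
    × ((N : ℕ) → ∃[ n ] (n ≥ N × n ≥ 1 × ms n ≡ 3 * n + 1))
    × ((N : ℕ) → ∃[ n ] (n ≥ N × n ≥ 1 × 5 * ms n ≡ 3 * n + 7))
lemma20 = ms-bounds , upper-tight-unbounded , lower-tight-unbounded
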